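{- Let $H$ be a graph and let $\mathcal{G}$ be the class of connected $H$-free graphs. Then: (1) $d_{\max}(\mathcal{G})$ is finite if and only if $H$ is a linear forest; and (2) if $H$ is a linear forest, $H=\sum_{i=1}^k P_{a_i}$ for integers $k\geq 1$ and $a_1,\dots,a_k\geq 1$, then $d_{\max}(\mathcal{G})=k-3+\sum_{i=1}^k a_i$.
   Context: Graphs are finite, simple, undirected and unweighted. A graph is $H$-free if it does not contain $H$ as an induced subgraph. $P_t$ is the path on $t$ vertices and $\sum_{i=1}^k P_{a_i}$ denotes the disjoint union of $P_{a_1},\dots,P_{a_k}$. A linear forest is a disjoint union of one or more paths. $\operatorname{diam}(G)=\max_{u,v}d(u,v)$ with $d$ the shortest-path distance, and $d_{\max}(\mathcal{G})=\sup_{G\in\mathcal{G}}\operatorname{diam}(G)$. -}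

module Defs where

open import Data.Nat using (ℕ; zero; suc; _+_; _≤_; _<_)
open import Data.Nat.Properties using (_≟_)
open import Data.Fin using (Fin; toℕ; splitAt)
open import Data.Bool using (Bool; true; false; _∨_)
open import Data.Sum using (_⊎_; inj₁; inj₂)
open import Data.Product using (Σ; ∃; ∃-syntax; _×_; _,_)
open import Data.List using (List; []; _∷_)
open import Data.List.Relation.Unary.All using (All)
open import Relation.Nullary using (¬_; ⌊_⌋)
open import Relation.Binary.PropositionalEquality using (_≡_; _≢_)
open import Function.Bundles using (_⤖_; Bijection)
open import Function.Definitions using (Injective)

record Graph : Set where
  constructor mkGraph
  field
    n   : ℕ
    adj : Fin n → Fin n → Bool
open Graph public

Simple : Graph → Set
Simple G = (∀ x y → adj G x y ≡ adj G y x) × (∀ x → adj G x x ≡ false)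

InducedSub : Graph → Graph → Set
InducedSub H G = Σ (Fin (n H) → Fin (n G)) λ f →
  Injective _≡_ _≡_ f × (∀ x y → adj H x y ≡ adj G (f x) (f y))

Free : Graph → Graph → Set
Free H G = ¬ InducedSub H G

_≅_ : Graph → Graph → Set
G ≅ H = Σ (Fin (n G) ⤖ Fin (n H)) λ φ →
  ∀ x y → adj G x y ≡ adj H (Bijection.to φ x) (Bijection.to φ y)

data Walk (G : Graph) : Fin (n G) → Fin (n G) → ℕ → Set where
  here : ∀ {u} → Walk G u u 0
  step : ∀ {u w v ℓ} → adj G u w ≡ true → Walk G w v ℓ → Walk G u v (suc ℓ)

Connected : Graph → Set
Connected G = (1 ≤ n G) × (∀ u v → ∃[ ℓ ] Walk G u v ℓ)

DistLe : (G : Graph) → Fin (n G) → Fin (n G) → ℕ → Set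
DistLe G u v D = ∃[ ℓ ] (ℓ ≤ D × Walk G u v ℓ)

DiamLe : Graph → ℕ → Set
DiamLe G D = ∀ u v → DistLe G u v D

DiamEq : Graph → ℕ → Set
DiamEq G D = DiamLe G D ×
  ∃[ u ] ∃[ v ] (∀ ℓ → Walk G u v ℓ → D ≤ ℓ)

InClass : Graph → Graph → Set
InClass H G = Simple G × Connected G × Free H G

DmaxFinite : Graph → Set
DmaxFinite H = ∃[ D ] (∀ G → InClass H G → DiamLe G D)

-- d_max(class) = D (supremum attained, as the class consists of
-- graphs with natural-number diameters).
DmaxEq : Graph → ℕ → Set
DmaxEq H D = (∀ G → InClass H G → DiamLe G D) × ∃[ G ] (InClass H G × DiamEq G D)

pathG : ℕ → Graph
pathG a = mkGraph a λ i j →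
  ⌊ toℕ j ≟ suc (toℕ i) ⌋ ∨ ⌊ toℕ i ≟ suc (toℕ j) ⌋

_⊕_ : Graph → Graph → Graph
G ⊕ H = mkGraph (n G + n H) λ x y → go (splitAt (n G) x) (splitAt (n G) y)
  where
  go : Fin (n G) ⊎ Fin (n H) → Fin (n G) ⊎ Fin (n H) → Bool
  go (inj₁ a) (inj₁ b) = adj G a b
  go (inj₂ a) (inj₂ b) = adj H a b
  go _ _ = false

emptyG : Graph
emptyG = mkGraph 0 λ ()

pathForest : List ℕ → Graph
pathForest [] = emptyG
pathForest (a ∷ as) = pathG a ⊕ pathForest as

LinearForest : Graph → Set
LinearForest H = ∃[ as ] (as ≢ [] × All (1 ≤_) as × H ≅ pathForest as)

{-# OPTIONS --safe #-}
-- A shortest walk is an induced path, so a connected P_{D+2}-free graph has diameter at most D.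
-- A linear forest with k components and s vertices is an induced subgraph of P_m iff
-- s + k ≤ m + 1: lay the paths out left to right with one free position between consecutive
-- ones; conversely, the position just above the topmost vertex of each component is free,
-- which yields s + k distinct positions among the m + 1 positions 0, …, m.
-- Hence for H = Σ P_{aᵢ} every connected H-free graph has diameter at most s + k − 3, and the
-- H-free path P_{s+k−2} attains it. Conversely, if all connected H-free graphs have diameter at
-- most D, then P_{D+2}, of diameter D + 1, contains H; and an induced subgraph of a path is a
-- linear forest whose components are the maximal runs of consecutive occupied positions.
module Submission where

open import Defs
open import Data.Nat
open import Data.Nat.Properties
open import Data.Nat.ListAction using (sum)
open import Data.Nat.Tactic.RingSolver using (solve-∀)
open import Data.Bool using (Bool; true; false; T; _∨_)
open import Data.Bool.Properties using (∨-comm; ¬-not) renaming (_≟_ to _≟ᴮ_)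
open import Data.Fin as F using (Fin; zero; suc; toℕ; fromℕ; fromℕ<; splitAt; join; _↑ʳ_)
open import Data.Fin.Properties
  using (toℕ-injective; toℕ<n; toℕ-fromℕ; toℕ-fromℕ<; fromℕ<-toℕ; fromℕ<-injective; join-splitAt; splitAt-↑ʳ;
         injective⇒≤; ¬Fin0; any?; all?)
open import Data.Vec.Functional using (head; tail) renaming (_∷_ to _∷ᵛ_)
open import Data.Sum using (_⊎_; inj₁; inj₂; [_,_]′)
open import Data.Product using (∃; _×_; _,_; proj₁; proj₂)
import Data.Product as Product
open import Data.List using (List; []; _∷_; length; map)
open import Data.List.Properties using (map-id; map-∘)
open import Data.List.Relation.Unary.All using (All; []; _∷_)
open import Data.Unit using (tt)
open import Function using (_∘_; id)
open import Function.Bundles using (mk⇔; mk⤖; Bijection; Surjection)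
open import Function.Definitions using (Injective)
open import Relation.Nullary using (¬_; Dec; yes; no; ⌊_⌋; contradiction)
open import Relation.Nullary.Decidable
  using (map′; _×-dec_; _→-dec_; does-⇔; isYes≗does; toWitness; fromWitness)
open import Relation.Unary using (Decidable)
open import Relation.Binary.PropositionalEquality
  using (_≡_; _≢_; _≗_; refl; sym; trans; cong; cong₂; subst; subst₂)
open import Relation.Binary.Definitions using (tri<; tri≈; tri>)

-- The path on ℕ; adj (pathG m) x y is definitionally pathAdj (toℕ x) (toℕ y).
pathAdj : ℕ → ℕ → Bool
pathAdj u v = ⌊ v ≟ suc u ⌋ ∨ ⌊ u ≟ suc v ⌋

pathAdj-sym : ∀ u v → pathAdj u v ≡ pathAdj v u
pathAdj-sym u v = ∨-comm ⌊ v ≟ suc u ⌋ ⌊ u ≟ suc v ⌋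

pathAdj-irrefl : ∀ u → pathAdj u u ≡ false
pathAdj-irrefl u with u ≟ suc u
... | yes u≡1+u = contradiction u≡1+u (<⇒≢ (n<1+n u))
... | no _ = refl

pathAdj-suc : ∀ u → pathAdj u (suc u) ≡ true
pathAdj-suc u with suc u ≟ suc u
... | yes _ = refl
... | no 1+u≢1+u = contradiction refl 1+u≢1+u

pathAdj-far : ∀ {u v} → suc u < v → pathAdj u v ≡ false
pathAdj-far {u} {v} 1+u<v with v ≟ suc u | u ≟ suc v
... | yes v≡1+u | _ = contradiction v≡1+u (>⇒≢ 1+u<v)
... | no _ | yes u≡1+v = contradiction u≡1+v (<⇒≢ (m<n⇒m<1+n (<-trans (n<1+n u) 1+u<v)))
... | no _ | no _ = refl

pathAdj⇒≤suc : ∀ {u v} → pathAdj u v ≡ true → v ≤ suc u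
pathAdj⇒≤suc {u} {v} e with v ≟ suc u | u ≟ suc v
... | yes v≡1+u | _ = ≤-reflexive v≡1+u
... | no _ | yes refl = ≤-trans (n≤1+n v) (n≤1+n (suc v))

pathAdj-+ : ∀ c u v → pathAdj (c + u) (c + v) ≡ pathAdj u v
pathAdj-+ zero u v = refl
pathAdj-+ (suc c) u v =
  trans (cong₂ _∨_ (⌊⌋-suc (c + v) (suc (c + u))) (⌊⌋-suc (c + u) (suc (c + v)))) (pathAdj-+ c u v)
  where
  ⌊⌋-suc : ∀ m n → ⌊ suc m ≟ suc n ⌋ ≡ ⌊ m ≟ n ⌋
  ⌊⌋-suc m n = trans (isYes≗does (suc m ≟ suc n))
    (trans (does-⇔ (mk⇔ suc-injective (cong suc)) (suc m ≟ suc n) (m ≟ n)) (sym (isYes≗does (m ≟ n))))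

-- Induced subgraphs and induced embeddings into the path on ℕ

InducedSub-trans : ∀ {A B C} → InducedSub A B → InducedSub B C → InducedSub A C
InducedSub-trans (f , f-inj , f-adj) (g , g-inj , g-adj) =
  g ∘ f , f-inj ∘ g-inj , λ x y → trans (f-adj x y) (g-adj (f x) (f y))

≅⇒InducedSub : ∀ {A B} → A ≅ B → InducedSub A B
≅⇒InducedSub (φ , φ-adj) = Bijection.to φ , Bijection.injective φ , φ-adj

≅⇒InducedSub⁻ : ∀ {A B} → A ≅ B → InducedSub B A
≅⇒InducedSub⁻ {A} {B} (φ , φ-adj) = to⁻ , to⁻-injective , to⁻-adj
  where
  open Surjection (Bijection.surjection φ) using (to; to⁻; to∘to⁻)
  to⁻-injective : Injective _≡_ _≡_ to⁻
  to⁻-injective {y} {y′} eq = trans (sym (to∘to⁻ y)) (trans (cong to eq) (to∘to⁻ y′))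
  to⁻-adj : ∀ y y′ → adj B y y′ ≡ adj A (to⁻ y) (to⁻ y′)
  to⁻-adj y y′ = sym (trans (φ-adj (to⁻ y) (to⁻ y′)) (cong₂ (adj B) (to∘to⁻ y) (to∘to⁻ y′)))

caseSplit : ∀ {A : Set} m {k} → (Fin m → A) → (Fin k → A) → Fin (m + k) → A
caseSplit m f h = [ f , h ]′ ∘ splitAt m

caseSplit-injective : ∀ {A : Set} m {k} {f : Fin m → A} {h : Fin k → A} →
  Injective _≡_ _≡_ f → Injective _≡_ _≡_ h → (∀ x y → f x ≢ h y) →
  Injective _≡_ _≡_ (caseSplit m f h)
caseSplit-injective m {k} {f} {h} f-inj h-inj f≢h {x} {y} eq =
  trans (sym (join-splitAt m k x))
        (trans (cong (join m k) (cases-injective {splitAt m x} {splitAt m y} eq)) (join-splitAt m k y))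
  where
  cases-injective : Injective _≡_ _≡_ [ f , h ]′
  cases-injective {inj₁ a} {inj₁ b} eq = cong inj₁ (f-inj eq)
  cases-injective {inj₁ a} {inj₂ b} eq = contradiction eq (f≢h a b)
  cases-injective {inj₂ a} {inj₁ b} eq = contradiction (sym eq) (f≢h b a)
  cases-injective {inj₂ a} {inj₂ b} eq = cong inj₂ (h-inj eq)

IsPathEmbedding : (H : Graph) → (Fin (n H) → ℕ) → Set
IsPathEmbedding H f = Injective _≡_ _≡_ f × (∀ x y → adj H x y ≡ pathAdj (f x) (f y))

InducedSub⇒pathEmbedding : ∀ {H m} (e : InducedSub H (pathG m)) → IsPathEmbedding H (toℕ ∘ proj₁ e)
InducedSub⇒pathEmbedding (g , g-inj , g-adj) = g-inj ∘ toℕ-injective , g-adj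

pathEmbedding⇒InducedSub : ∀ {H m f} → IsPathEmbedding H f → (∀ x → f x < m) → InducedSub H (pathG m)
pathEmbedding⇒InducedSub {f = f} (f-inj , f-adj) f<m =
  (λ x → fromℕ< (f<m x)) , (λ eq → f-inj (fromℕ<-injective _ _ (f<m _) (f<m _) eq)) ,
  λ x y → trans (f-adj x y) (sym (cong₂ pathAdj (toℕ-fromℕ< (f<m x)) (toℕ-fromℕ< (f<m y))))

toℕ-pathEmbedding : ∀ m → IsPathEmbedding (pathG m) toℕ
toℕ-pathEmbedding m = toℕ-injective , λ _ _ → refl

+-pathEmbedding : ∀ {H f} c → IsPathEmbedding H f → IsPathEmbedding H ((c +_) ∘ f)
+-pathEmbedding c (f-inj , f-adj) =
  f-inj ∘ +-cancelˡ-≡ c _ _ , λ x y → trans (f-adj x y) (sym (pathAdj-+ c _ _))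

⊕-pathEmbedding : ∀ {G H f h} → IsPathEmbedding G f → IsPathEmbedding H h →
  (∀ x y → suc (f x) < h y) → IsPathEmbedding (G ⊕ H) (caseSplit (n G) f h)
⊕-pathEmbedding {G} {H} {f} {h} (f-inj , f-adj) (h-inj , h-adj) gap =
  caseSplit-injective (n G) f-inj h-inj (λ x y → <⇒≢ (<-trans (n<1+n (f x)) (gap x y))) , ⊕-adj
  where
  ⊕-adj : ∀ x y → adj (G ⊕ H) x y ≡ pathAdj (caseSplit (n G) f h x) (caseSplit (n G) f h y)
  ⊕-adj x y with splitAt (n G) x | splitAt (n G) y
  ... | inj₁ i | inj₁ j = f-adj i j
  ... | inj₁ i | inj₂ j = sym (pathAdj-far (gap i j))
  ... | inj₂ i | inj₁ j = sym (trans (pathAdj-sym (h i) (f j)) (pathAdj-far (gap j i)))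
  ... | inj₂ i | inj₂ j = h-adj i j

-- Walks; shortest walks are induced paths

module _ {G : Graph} where

  _++ʷ_ : ∀ {u v w ℓ ℓ′} → Walk G u v ℓ → Walk G v w ℓ′ → Walk G u w (ℓ + ℓ′)
  here ++ʷ q = q
  step e p ++ʷ q = step e (p ++ʷ q)

  reverseʷ : (∀ x y → adj G x y ≡ adj G y x) → ∀ {u v ℓ} → Walk G u v ℓ → Walk G v u ℓ
  reverseʷ adj-sym here = here
  reverseʷ adj-sym (step {ℓ = ℓ} e p) =
    subst (Walk G _ _) (+-comm ℓ 1) (reverseʷ adj-sym p ++ʷ step (trans (adj-sym _ _) e) here)

  walk? : ∀ u v ℓ → Dec (Walk G u v ℓ)
  walk? u v zero = map′ (λ { refl → here }) (λ { here → refl }) (u F.≟ v)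
  walk? u v (suc ℓ) =
    map′ (λ (w , e , p) → step e p) (λ { (step e p) → _ , e , p })
         (any? λ w → (adj G u w ≟ᴮ true) ×-dec walk? w v ℓ)

  vertexAt : ∀ {u v ℓ} → Walk G u v ℓ → ℕ → Fin (n G)
  vertexAt {u} p zero = u
  vertexAt {v = v} here (suc i) = v
  vertexAt (step _ p) (suc i) = vertexAt p i

  takeʷ : ∀ {u v ℓ} (p : Walk G u v ℓ) {i} → i ≤ ℓ → Walk G u (vertexAt p i) i
  takeʷ p {zero} _ = here
  takeʷ (step e p) {suc i} (s≤s i≤ℓ) = step e (takeʷ p i≤ℓ)

  dropʷ : ∀ {u v ℓ} (p : Walk G u v ℓ) {i} → i ≤ ℓ → Walk G (vertexAt p i) v (ℓ ∸ i)
  dropʷ p {zero} _ = p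
  dropʷ (step e p) {suc i} (s≤s i≤ℓ) = dropʷ p i≤ℓ

  vertexAt-adj : ∀ {u v ℓ} (p : Walk G u v ℓ) {i} → i < ℓ → adj G (vertexAt p i) (vertexAt p (suc i)) ≡ true
  vertexAt-adj (step e p) {zero} _ = e
  vertexAt-adj (step e p) {suc i} (s≤s i<ℓ) = vertexAt-adj p i<ℓ

Least : (ℕ → Set) → ℕ → Set
Least P m = P m × (∀ {j} → j < m → ¬ P j)

module _ {P : ℕ → Set} (P? : ∀ m → Dec (P m)) where

  least-or-none< : ∀ k → ∃ (Least P) ⊎ (∀ {j} → j < k → ¬ P j)
  least-or-none< zero = inj₂ λ ()
  least-or-none< (suc k) with least-or-none< k | P? k
  ... | inj₁ found | _ = inj₁ found
  ... | inj₂ none | yes p = inj₁ (k , p , none)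
  ... | inj₂ none | no ¬p = inj₂ λ j<1+k → [ none , (λ { refl → ¬p }) ]′ (m<1+n⇒m<n∨m≡n j<1+k)

  least : ∀ {m} → P m → ∃ (Least P)
  least {m} p = [ id , (λ none → contradiction p (none (n<1+n m))) ]′ (least-or-none< (suc m))

module ShortestWalk {G : Graph} (simple : Simple G) {u v ℓ} (shortestWalk : Least (Walk G u v) ℓ) where

  private
    w = proj₁ shortestWalk
    shortest = proj₂ shortestWalk

  -- Stated with d + i so that d = 0 and d = 1 give i and suc i definitionally.
  no-shortcut : ∀ {i j d} → d + i < j → j ≤ ℓ → ¬ Walk G (vertexAt w i) (vertexAt w j) d
  no-shortcut {i} {j} {d} d+i<j j≤ℓ p =
    shortest shorter (takeʷ w (≤-trans i≤j j≤ℓ) ++ʷ (p ++ʷ dropʷ w j≤ℓ))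
    where
    open ≤-Reasoning
    i≤j : i ≤ j
    i≤j = ≤-trans (m≤n+m i d) (<⇒≤ d+i<j)
    shorter : i + (d + (ℓ ∸ j)) < ℓ
    shorter = begin-strict
      i + (d + (ℓ ∸ j)) ≡⟨ sym (+-assoc i d _) ⟩
      i + d + (ℓ ∸ j)   ≡⟨ cong (_+ (ℓ ∸ j)) (+-comm i d) ⟩
      d + i + (ℓ ∸ j)   <⟨ +-monoˡ-< (ℓ ∸ j) d+i<j ⟩
      j + (ℓ ∸ j)       ≡⟨ m+[n∸m]≡n j≤ℓ ⟩
      ℓ                 ∎

  vertexAt-injective : ∀ {i j} → i < j → j ≤ ℓ → vertexAt w i ≢ vertexAt w j
  vertexAt-injective i<j j≤ℓ eq = no-shortcut i<j j≤ℓ (subst (λ x → Walk G _ x 0) eq here)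

  vertexAt-nonadj : ∀ {i j} → suc i < j → j ≤ ℓ → adj G (vertexAt w i) (vertexAt w j) ≡ false
  vertexAt-nonadj 1+i<j j≤ℓ = ¬-not λ e → no-shortcut 1+i<j j≤ℓ (step e here)

  pathAdj≡adj-< : ∀ {i j} → i < j → j ≤ ℓ → pathAdj i j ≡ adj G (vertexAt w i) (vertexAt w j)
  pathAdj≡adj-< {i} {j} i<j j≤ℓ with suc i ≟ j
  ... | yes refl = trans (pathAdj-suc i) (sym (vertexAt-adj w j≤ℓ))
  ... | no 1+i≢j = let 1+i<j = ≤∧≢⇒< i<j 1+i≢j in
                   trans (pathAdj-far 1+i<j) (sym (vertexAt-nonadj 1+i<j j≤ℓ))

  induced : InducedSub (pathG (suc ℓ)) G
  induced = vertexAt w ∘ toℕ , (λ eq → toℕ-injective (injective eq)) , λ x y → pathAdj≡adj (bound x) (bound y)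
    where
    bound : ∀ (x : Fin (suc ℓ)) → toℕ x ≤ ℓ
    bound x = s≤s⁻¹ (toℕ<n x)
    injective : ∀ {x y : Fin (suc ℓ)} → vertexAt w (toℕ x) ≡ vertexAt w (toℕ y) → toℕ x ≡ toℕ y
    injective {x} {y} eq with <-cmp (toℕ x) (toℕ y)
    ... | tri< x<y _ _ = contradiction eq (vertexAt-injective x<y (bound y))
    ... | tri≈ _ x≡y _ = x≡y
    ... | tri> _ _ y<x = contradiction (sym eq) (vertexAt-injective y<x (bound x))
    pathAdj≡adj : ∀ {i j} → i ≤ ℓ → j ≤ ℓ → pathAdj i j ≡ adj G (vertexAt w i) (vertexAt w j)
    pathAdj≡adj {i} {j} i≤ℓ j≤ℓ with <-cmp i j
    ... | tri< i<j _ _ = pathAdj≡adj-< i<j j≤ℓ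
    ... | tri≈ _ refl _ = trans (pathAdj-irrefl i) (sym (proj₂ simple _))
    ... | tri> _ _ j<i = trans (pathAdj-sym i j) (trans (pathAdj≡adj-< j<i i≤ℓ) (proj₁ simple _ _))

path⊑path : ∀ {m m′} → m ≤ m′ → InducedSub (pathG m) (pathG m′)
path⊑path m≤m′ = pathEmbedding⇒InducedSub (toℕ-pathEmbedding _) (λ x → ≤-trans (toℕ<n x) m≤m′)

pathFree⇒diamLe : ∀ {G} D → Simple G → Connected G → Free (pathG (2 + D)) G → DiamLe G D
pathFree⇒diamLe {G} D simple (_ , connected) free u v with least (walk? u v) (proj₂ (connected u v))
... | ℓ , shortest with ℓ ≤? D
...   | yes ℓ≤D = ℓ , ℓ≤D , proj₁ shortest
...   | no ℓ≰D = contradiction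
  (InducedSub-trans {C = G} (path⊑path (s≤s (≰⇒> ℓ≰D))) (ShortestWalk.induced simple shortest)) free

diamEq-≤ : ∀ {G D D′} → DiamEq G D → DiamLe G D′ → D ≤ D′
diamEq-≤ (_ , u , v , far) bounded with bounded u v
... | ℓ , ℓ≤D′ , p = ≤-trans (far ℓ p) ℓ≤D′

path-simple : ∀ m → Simple (pathG m)
path-simple m = (λ x y → pathAdj-sym (toℕ x) (toℕ y)) , λ x → pathAdj-irrefl (toℕ x)

path-walkToZero : ∀ {m} (u : Fin (suc m)) → Walk (pathG (suc m)) u zero (toℕ u)
path-walkToZero {m} u =
  subst (λ x → Walk _ x zero (toℕ u)) (fromℕ<-toℕ u (toℕ<n u)) (descend (toℕ u) (toℕ<n u))
  where
  descend : ∀ k (k<1+m : k < suc m) → Walk (pathG (suc m)) (fromℕ< k<1+m) zero k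
  descend zero _ = here
  descend (suc k) 1+k<1+m = step adjacent (descend k k<1+m)
    where
    k<1+m = <-trans (n<1+n k) 1+k<1+m
    adjacent : pathAdj (toℕ (fromℕ< 1+k<1+m)) (toℕ (fromℕ< k<1+m)) ≡ true
    adjacent = subst₂ (λ a b → pathAdj a b ≡ true) (sym (toℕ-fromℕ< 1+k<1+m)) (sym (toℕ-fromℕ< k<1+m))
                      (trans (pathAdj-sym (suc k) k) (pathAdj-suc k))

path-connected : ∀ m → Connected (pathG (suc m))
path-connected m = s≤s z≤n , λ u v →
  _ , path-walkToZero u ++ʷ reverseʷ (proj₁ (path-simple (suc m))) (path-walkToZero v)

path-walk-≤ : ∀ {m u v ℓ} → Walk (pathG m) u v ℓ → toℕ v ≤ toℕ u + ℓ
path-walk-≤ {u = u} here = m≤m+n (toℕ u) 0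
path-walk-≤ {u = u} {v} (step {w = w} {ℓ = ℓ} e p) = begin
  toℕ v            ≤⟨ path-walk-≤ p ⟩
  toℕ w + ℓ        ≤⟨ +-monoˡ-≤ ℓ (pathAdj⇒≤suc e) ⟩
  suc (toℕ u) + ℓ  ≡⟨ sym (+-suc (toℕ u) ℓ) ⟩
  toℕ u + suc ℓ    ∎
  where open ≤-Reasoning

path-diamEq : ∀ m → DiamEq (pathG (suc m)) m
path-diamEq m = diamLe , zero , fromℕ m , λ ℓ p → subst (_≤ ℓ) (toℕ-fromℕ m) (path-walk-≤ p)
  where
  diamLe : DiamLe (pathG (suc m)) m
  diamLe = pathFree⇒diamLe m (path-simple _) (path-connected m) λ (_ , f-inj , _) → 1+n≰n (injective⇒≤ f-inj)

-- Linear forests inside paths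

-- A block (g , a) is a copy of P_a preceded by g free positions; after each copy one more
-- position is left free.
place : (bl : List (ℕ × ℕ)) → Fin (n (pathForest (map proj₂ bl))) → ℕ
place [] ()
place ((g , a) ∷ bl) = (g +_) ∘ caseSplit a toℕ ((suc a +_) ∘ place bl)

place-pathEmbedding : ∀ bl → IsPathEmbedding (pathForest (map proj₂ bl)) (place bl)
place-pathEmbedding [] = (λ { {()} }) , λ ()
place-pathEmbedding ((g , a) ∷ bl) =
  +-pathEmbedding g
    (⊕-pathEmbedding (toℕ-pathEmbedding a) (+-pathEmbedding (suc a) (place-pathEmbedding bl)) gap)
  where
  gap : ∀ i y → suc (toℕ i) < suc a + place bl y
  gap i y = s≤s (≤-trans (toℕ<n i) (m≤m+n a (place bl y)))

tight : List ℕ → List (ℕ × ℕ)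
tight = map (0 ,_)

place-tight-< : ∀ as y → suc (place (tight as) y) < length as + sum as
place-tight-< (a ∷ as) y with splitAt a y
... | inj₁ i = s≤s (≤-trans (toℕ<n i) (≤-trans (m≤m+n a (sum as)) (m≤n+m (a + sum as) (length as))))
... | inj₂ y′ = begin
  3 + (a + p)                   ≡⟨ cong suc (sym (trans (+-suc a (suc p)) (cong suc (+-suc a p)))) ⟩
  suc (a + suc (suc p))         ≤⟨ s≤s (+-monoʳ-≤ a (place-tight-< as y′)) ⟩
  suc (a + (length as + sum as)) ≡⟨ cong suc (+-comm-middle a (length as) (sum as)) ⟩
  suc (length as + (a + sum as)) ∎
  where
  open ≤-Reasoning
  p = place (tight as) y′
  +-comm-middle : ∀ a k s → a + (k + s) ≡ k + (a + s)
  +-comm-middle = solve-∀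

pathForest⊑path : ∀ {as m} → length as + sum as ≤ suc m → InducedSub (pathForest as) (pathG m)
pathForest⊑path {as} {m} fits =
  subst (λ bs → InducedSub (pathForest bs) (pathG m)) (trans (sym (map-∘ as)) (map-id as))
    (pathEmbedding⇒InducedSub (place-pathEmbedding (tight as))
      λ y → s≤s⁻¹ (≤-trans (place-tight-< as y) fits))

bounded-injection⇒≤ : ∀ {N M} (ψ : Fin N → ℕ) → Injective _≡_ _≡_ ψ → (∀ x → ψ x < M) → N ≤ M
bounded-injection⇒≤ ψ ψ-inj ψ<M =
  injective⇒≤ {f = λ x → fromℕ< (ψ<M x)} (λ eq → ψ-inj (fromℕ<-injective _ _ (ψ<M _) (ψ<M _) eq))

IsArgmax : ∀ {N} → (Fin N → Set) → (Fin N → ℕ) → Fin N → Set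
IsArgmax P h x = P x × ∀ y → P y → h y ≤ h x

argmax : ∀ {N} {P : Fin N → Set} → Decidable P → (h : Fin N → ℕ) → ∃ P → ∃ (IsArgmax P h)
argmax {suc N} {P} P? h (x₀ , p₀) with any? (P? ∘ suc)
... | no none = zero , P-zero x₀ p₀ , λ { zero _ → ≤-refl ; (suc y) py → contradiction (y , py) none }
  where
  P-zero : ∀ x → P x → P zero
  P-zero zero p = p
  P-zero (suc y) p = contradiction (y , p) none
... | yes some with argmax (P? ∘ suc) (h ∘ suc) some | P? zero
...   | x , px , max | no ¬p0 = suc x , px , λ { zero p0 → contradiction p0 ¬p0 ; (suc y) → max y }
...   | x , px , max | yes p0 with h zero ≤? h (suc x)
...     | yes h0≤ = suc x , px , λ { zero _ → h0≤ ; (suc y) → max y }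
...     | no h0≰ = zero , p0 , λ { zero _ → ≤-refl ; (suc y) py → ≤-trans (max y py) (<⇒≤ (≰⇒> h0≰)) }

pathEmbedding-components-≤ : ∀ {G f m k} → IsPathEmbedding G f → (∀ x → f x < m) →
  (c : Fin (n G) → Fin k) → (∀ x y → adj G x y ≡ true → c x ≡ c y) → (∀ i → ∃ λ x → c x ≡ i) →
  k + n G ≤ suc m
pathEmbedding-components-≤ {G} {f} {m} {k} (f-inj , f-adj) f<m c c-adj c-surj =
  bounded-injection⇒≤ ψ (caseSplit-injective k top-injective f-inj free-above-top) ψ<1+m
  where
  top : ∀ i → ∃ (IsArgmax (λ x → c x ≡ i) f)
  top i = argmax (λ x → c x F.≟ i) f (c-surj i)
  t : Fin k → Fin (n G)
  t i = proj₁ (top i)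
  above-top : Fin k → ℕ
  above-top i = suc (f (t i))
  top-injective : Injective _≡_ _≡_ above-top
  top-injective {i} {j} eq =
    trans (sym (proj₁ (proj₂ (top i)))) (trans (cong c (f-inj (suc-injective eq))) (proj₁ (proj₂ (top j))))
  free-above-top : ∀ i x → above-top i ≢ f x
  free-above-top i x eq = 1+n≰n (≤-trans (≤-reflexive eq) (proj₂ (proj₂ (top i)) x same-component))
    where
    adjacent : adj G (t i) x ≡ true
    adjacent = trans (f-adj (t i) x) (subst (λ v → pathAdj (f (t i)) v ≡ true) eq (pathAdj-suc (f (t i))))
    same-component : c x ≡ i
    same-component = trans (sym (c-adj _ _ adjacent)) (proj₁ (proj₂ (top i)))
  ψ = caseSplit k above-top f
  ψ<1+m : ∀ z → ψ z < suc m
  ψ<1+m z with splitAt k z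
  ... | inj₁ i = s≤s (f<m (t i))
  ... | inj₂ x = m<n⇒m<1+n (f<m x)

block : ∀ as → Fin (n (pathForest as)) → Fin (length as)
block (a ∷ as) = caseSplit a (λ _ → zero) (suc ∘ block as)

block-adj : ∀ as x y → adj (pathForest as) x y ≡ true → block as x ≡ block as y
block-adj (a ∷ as) x y e with splitAt a x | splitAt a y
block-adj (a ∷ as) x y e  | inj₁ _ | inj₁ _ = refl
block-adj (a ∷ as) x y () | inj₁ _ | inj₂ _
block-adj (a ∷ as) x y () | inj₂ _ | inj₁ _
block-adj (a ∷ as) x y e  | inj₂ x′ | inj₂ y′ = cong suc (block-adj as x′ y′ e)

block-surjective : ∀ {as} → All (1 ≤_) as → ∀ i → ∃ λ x → block as x ≡ i
block-surjective {suc a ∷ as} (_ ∷ _) zero = zero , refl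
block-surjective {a ∷ as} (_ ∷ ps) (suc i) with block-surjective ps i
... | x , refl = a ↑ʳ x , cong [ (λ _ → zero) , suc ∘ block as ]′ (splitAt-↑ʳ a _ x)

n-pathForest : ∀ as → n (pathForest as) ≡ sum as
n-pathForest [] = refl
n-pathForest (a ∷ as) = cong (a +_) (n-pathForest as)

pathForest⊑path⇒ : ∀ {as m} → All (1 ≤_) as → InducedSub (pathForest as) (pathG m) →
  length as + sum as ≤ suc m
pathForest⊑path⇒ {as} {m} ps e@(g , _) = subst (λ s → length as + s ≤ suc m) (n-pathForest as)
  (pathEmbedding-components-≤ (InducedSub⇒pathEmbedding e) (toℕ<n ∘ g)
    (block as) (block-adj as) (block-surjective ps))

-- Induced subgraphs of paths are linear forests

sameImage⇒≅ : ∀ {G H f h} → IsPathEmbedding G f → IsPathEmbedding H h →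
  (∀ x → ∃ λ y → h y ≡ f x) → (∀ y → ∃ λ x → f x ≡ h y) → G ≅ H
sameImage⇒≅ {G} {H} {f} {h} (f-inj , f-adj) (h-inj , h-adj) f⊆h h⊆f =
  mk⤖ (φ-injective , φ-surjective) , φ-adj
  where
  φ : Fin (n G) → Fin (n H)
  φ x = proj₁ (f⊆h x)
  h∘φ : ∀ x → h (φ x) ≡ f x
  h∘φ x = proj₂ (f⊆h x)
  φ-injective : Injective _≡_ _≡_ φ
  φ-injective {x} {x′} eq = f-inj (trans (sym (h∘φ x)) (trans (cong h eq) (h∘φ x′)))
  φ-surjective : ∀ y → ∃ λ x → ∀ {z} → z ≡ x → φ z ≡ y
  φ-surjective y = proj₁ (h⊆f y) , λ { refl → h-inj (trans (h∘φ _) (proj₂ (h⊆f y))) }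
  φ-adj : ∀ x x′ → adj G x x′ ≡ adj H (φ x) (φ x′)
  φ-adj x x′ = trans (f-adj x x′) (sym (trans (h-adj (φ x) (φ x′)) (cong₂ pathAdj (h∘φ x) (h∘φ x′))))

Placed : List (ℕ × ℕ) → ℕ → Set
Placed bl v = ∃ λ y → place bl y ≡ v

push : Bool → List (ℕ × ℕ) → List (ℕ × ℕ)
push false [] = []
push false ((g , a) ∷ bl) = (suc g , a) ∷ bl
push true [] = (0 , 1) ∷ []
push true ((zero , a) ∷ bl) = (0 , suc a) ∷ bl
push true ((suc g , a) ∷ bl) = (0 , 1) ∷ (g , a) ∷ bl

-- The maximal runs of consecutive positions v < m with s v, as blocks.
runs : (ℕ → Bool) → ℕ → List (ℕ × ℕ)
runs s zero = []
runs s (suc m) = push (s 0) (runs (s ∘ suc) m)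

place-grow : ∀ a bl x → place ((0 , suc a) ∷ bl) (suc x) ≡ suc (place ((0 , a) ∷ bl) x)
place-grow a bl x with splitAt a x
... | inj₁ _ = refl
... | inj₂ _ = refl

placed-push-zero⁺ : ∀ b bl → T b → Placed (push b bl) 0
placed-push-zero⁺ true [] _ = zero , refl
placed-push-zero⁺ true ((zero , a) ∷ bl) _ = zero , refl
placed-push-zero⁺ true ((suc g , a) ∷ bl) _ = zero , refl

placed-push-zero⁻ : ∀ b bl → Placed (push b bl) 0 → T b
placed-push-zero⁻ false ((g , a) ∷ bl) (_ , ())
placed-push-zero⁻ true _ _ = tt

placed-push-suc⁺ : ∀ b bl {v} → Placed bl v → Placed (push b bl) (suc v)
placed-push-suc⁺ false ((g , a) ∷ bl) (y , eq) = y , cong suc eq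
placed-push-suc⁺ true ((zero , a) ∷ bl) (y , eq) = suc y , trans (place-grow a bl y) (cong suc eq)
placed-push-suc⁺ true ((suc g , a) ∷ bl) (y , eq) = suc y , cong suc eq

placed-push-suc⁻ : ∀ b bl {v} → Placed (push b bl) (suc v) → Placed bl v
placed-push-suc⁻ false ((g , a) ∷ bl) (y , eq) = y , suc-injective eq
placed-push-suc⁻ true [] (zero , ())
placed-push-suc⁻ true ((zero , a) ∷ bl) (zero , ())
placed-push-suc⁻ true ((zero , a) ∷ bl) (suc y , eq) = y , suc-injective (trans (sym (place-grow a bl y)) eq)
placed-push-suc⁻ true ((suc g , a) ∷ bl) (zero , ())
placed-push-suc⁻ true ((suc g , a) ∷ bl) (suc y , eq) = y , suc-injective eq

runs-placed⁺ : ∀ s m {v} → v < m → T (s v) → Placed (runs s m) v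
runs-placed⁺ s (suc m) {zero} _ sv = placed-push-zero⁺ (s 0) _ sv
runs-placed⁺ s (suc m) {suc v} (s≤s v<m) sv = placed-push-suc⁺ (s 0) _ (runs-placed⁺ (s ∘ suc) m v<m sv)

runs-placed⁻ : ∀ s m {v} → Placed (runs s m) v → v < m × T (s v)
runs-placed⁻ s (suc m) {zero} p = z<s , placed-push-zero⁻ (s 0) _ p
runs-placed⁻ s (suc m) {suc v} p = Product.map₁ s≤s (runs-placed⁻ (s ∘ suc) m (placed-push-suc⁻ (s 0) _ p))

push-positive : ∀ b bl → All (1 ≤_) (map proj₂ bl) → All (1 ≤_) (map proj₂ (push b bl))
push-positive false [] _ = []
push-positive false (_ ∷ _) ps = ps
push-positive true [] _ = s≤s z≤n ∷ []
push-positive true ((zero , a) ∷ _) (_ ∷ ps) = s≤s z≤n ∷ ps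
push-positive true ((suc g , a) ∷ _) ps = s≤s z≤n ∷ ps

runs-positive : ∀ s m → All (1 ≤_) (map proj₂ (runs s m))
runs-positive s zero = []
runs-positive s (suc m) = push-positive (s 0) _ (runs-positive (s ∘ suc) m)

≅pathForest⇒nonempty : ∀ {H as} → 1 ≤ n H → H ≅ pathForest as → as ≢ []
≅pathForest⇒nonempty 1≤n (φ , _) refl = ¬Fin0 (Bijection.to φ (fromℕ< 1≤n))

⊑path⇒linearForest : ∀ {H m} → 1 ≤ n H → InducedSub H (pathG m) → LinearForest H
⊑path⇒linearForest {H} {m} 1≤n e@(g , _) =
  map proj₂ bl , ≅pathForest⇒nonempty 1≤n H≅F , runs-positive s m , H≅F
  where
  s : ℕ → Bool
  s v = ⌊ any? (λ x → toℕ (g x) ≟ v) ⌋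
  bl = runs s m
  H≅F : H ≅ pathForest (map proj₂ bl)
  H≅F = sameImage⇒≅ (InducedSub⇒pathEmbedding e) (place-pathEmbedding bl)
    (λ x → runs-placed⁺ s m (toℕ<n (g x)) (fromWitness (x , refl)))
    (λ y → toWitness (proj₂ (runs-placed⁻ s m (y , refl))))

anyFunction? : ∀ a {b} {P : (Fin a → Fin b) → Set} → (∀ {f g} → f ≗ g → P f → P g) →
  (∀ f → Dec (P f)) → Dec (∃ P)
anyFunction? zero P-respects-≗ P? = map′ (_ ,_) (λ (_ , p) → P-respects-≗ (λ ()) p) (P? λ ())
anyFunction? (suc a) {P = P} P-respects-≗ P? =
  map′ (λ (c , f , p) → c ∷ᵛ f , p) (λ (f , p) → head f , tail f , P-respects-≗ head∷tail p)
       (any? λ c → anyFunction? a (λ f≗g → P-respects-≗ (λ { zero → refl ; (suc i) → f≗g i }))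
                                (P? ∘ (c ∷ᵛ_)))
  where
  head∷tail : ∀ {f : Fin (suc a) → _} → f ≗ head f ∷ᵛ tail f
  head∷tail zero = refl
  head∷tail (suc i) = refl

InducedSub? : ∀ H G → Dec (InducedSub H G)
InducedSub? H G = anyFunction? (n H) respects-≗ λ f → injective? f ×-dec preserves? f
  where
  injective? : ∀ f → Dec (Injective _≡_ _≡_ f)
  injective? f = map′ (λ inj {x} {y} → inj x y) (λ inj x y → inj)
                      (all? λ x → all? λ y → (f x F.≟ f y) →-dec (x F.≟ y))
  preserves? : ∀ f → Dec (∀ x y → adj H x y ≡ adj G (f x) (f y))
  preserves? f = all? λ x → all? λ y → adj H x y ≟ᴮ adj G (f x) (f y)
  respects-≗ : ∀ {f g} → f ≗ g → Injective _≡_ _≡_ f × (∀ x y → adj H x y ≡ adj G (f x) (f y)) →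
                           Injective _≡_ _≡_ g × (∀ x y → adj H x y ≡ adj G (g x) (g y))
  respects-≗ f≗g (f-inj , f-adj) = (λ {x} {y} eq → f-inj (trans (f≗g x) (trans eq (sym (f≗g y))))) ,
                             λ x y → trans (f-adj x y) (cong₂ (adj G) (f≗g x) (f≗g y))

-- Diameters of connected H-free graphs

path-inClass : ∀ {H m} → Free H (pathG (suc m)) → InClass H (pathG (suc m))
path-inClass {m = m} free = path-simple _ , path-connected m , free

linearForest⊑path : ∀ {H as m} → H ≅ pathForest as → length as + sum as ≤ suc m → InducedSub H (pathG m)
linearForest⊑path {H} {as} {m} H≅F fits =
  InducedSub-trans {H} {pathForest as} {pathG m}
    (≅⇒InducedSub {H} {pathForest as} H≅F) (pathForest⊑path {as} fits)

linearForest⊑path⇒ : ∀ {H as m} → All (1 ≤_) as → H ≅ pathForest as → InducedSub H (pathG m) →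
  length as + sum as ≤ suc m
linearForest⊑path⇒ {H} {as} {m} ps H≅F H⊑P =
  pathForest⊑path⇒ ps
    (InducedSub-trans {pathForest as} {H} {pathG m} (≅⇒InducedSub⁻ {H} {pathForest as} H≅F) H⊑P)

linearForest-diamLe : ∀ {H as} → H ≅ pathForest as → ∀ G → InClass H G → DiamLe G (length as + sum as ∸ 3)
linearForest-diamLe {H} {as} H≅F G (simple , connected , free) =
  pathFree⇒diamLe _ simple connected λ P⊑G →
    free (InducedSub-trans {C = G} (linearForest⊑path {H} {as} H≅F (m≤n+m∸n (length as + sum as) 3)) P⊑G)

linearForest-free : ∀ {H as} → All (1 ≤_) as → H ≅ pathForest as → 3 ≤ length as + sum as →
  Free H (pathG (suc (length as + sum as ∸ 3)))
linearForest-free {H} {as} ps H≅F 3≤t H⊑P = 1+n≰n (subst (_≤ 2 + D) (sym (m+[n∸m]≡n 3≤t))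
  (linearForest⊑path⇒ {H} {m = suc D} ps H≅F H⊑P))
  where D = length as + sum as ∸ 3

dmaxFinite⇒linearForest : ∀ {H} → 1 ≤ n H → DmaxFinite H → LinearForest H
dmaxFinite⇒linearForest {H} 1≤n (D , bounded) with InducedSub? H (pathG (2 + D))
... | yes H⊑P = ⊑path⇒linearForest 1≤n H⊑P
... | no H⋢P = contradiction (diamEq-≤ (path-diamEq (suc D)) (bounded _ (path-inClass {H} H⋢P))) 1+n≰n

theorem6 : (H : Graph) → Simple H → 1 ≤ n H →
    ((DmaxFinite H → LinearForest H) × (LinearForest H → DmaxFinite H)) ×
    ((as : List ℕ) → as ≢ [] → All (1 ≤_) as → H ≅ pathForest as → 2 ≤ sum as →
      DmaxEq H (length as + sum as ∸ 3))
theorem6 H _ 1≤n = (dmaxFinite⇒linearForest 1≤n , linearForest⇒dmaxFinite) , dmaxEq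
  where
  linearForest⇒dmaxFinite : LinearForest H → DmaxFinite H
  linearForest⇒dmaxFinite (as , _ , _ , H≅F) = _ , linearForest-diamLe {H} {as} H≅F

  dmaxEq : (as : List ℕ) → as ≢ [] → All (1 ≤_) as → H ≅ pathForest as → 2 ≤ sum as →
           DmaxEq H (length as + sum as ∸ 3)
  dmaxEq [] []≢[] = contradiction refl []≢[]
  dmaxEq as@(_ ∷ _) _ ps H≅F 2≤sum =
    linearForest-diamLe {H} {as} H≅F , _ , path-inClass {H} (linearForest-free ps H≅F 3≤t) , path-diamEq _
    where
    3≤t : 3 ≤ length as + sum as
    3≤t = +-mono-≤ {1} {length as} (s≤s z≤n) 2≤sum
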